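{- Let $p=(p_1,\dots,p_n)$ be a permutation, run the recursive (non-resampling) Disappear-Sort procedure on $p$, and let $D(p)$ be the total number of passes until the procedure terminates. Define $i\prec j$ iff $i<j$ and $p_i>p_j$. Then there exists a chain $i_1\prec i_2\prec\cdots\prec i_{D(p)}$ with $D(p)$ elements. In particular, if $L(p)$ denotes the size of the longest $\prec$-chain, then $L(p)\ge D(p)$.
   Context: A Disappear-Sort pass on a list of distinct reals scans left to right and retains exactly the left-to-right records (entries larger than all earlier entries of the list; the first entry is always retained), discarding all other entries. The recursive non-resampling procedure applies a pass to $p$, then applies a pass to the list of discarded entries (kept in their original relative order), and so on, until the list of discarded entries is empty. $D(p)$ is the number of passes performed. -}

module Defs where

open import Data.Nat using (ℕ; zero; suc; _<_; _<ᵇ_)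
open import Data.Bool using (Bool; true; false; if_then_else_)
open import Data.List using (List; []; _∷_; length; tabulate)
open import Data.Product using (_×_; _,_)
open import Data.Fin using (Fin; toℕ)
open import Function using (_∘_)

-- One Disappear-Sort pass, given the current running maximum m:
-- returns (retained entries, discarded entries), both in original order.
passFrom : ℕ → List ℕ → List ℕ × List ℕ
passFrom m [] = [] , []
passFrom m (x ∷ xs) with m <ᵇ x
... | true  with passFrom x xs
...   | (r , d) = (x ∷ r) , d
passFrom m (x ∷ xs) | false with passFrom m xs
...   | (r , d) = r , (x ∷ d)

pass : List ℕ → List ℕ × List ℕ
pass [] = [] , []
pass (x ∷ xs) with passFrom x xs
... | (r , d) = (x ∷ r) , d

discarded : List ℕ → List ℕ
discarded xs with pass xs
... | (_ , d) = d

-- Number of passes, with fuel. Each pass on a nonempty list discards at most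
-- length - 1 entries, so fuel = length of the list suffices.
passesFuel : ℕ → List ℕ → ℕ
passesFuel _ [] = 0
passesFuel zero (_ ∷ _) = 0
passesFuel (suc k) (x ∷ xs) = suc (passesFuel k (discarded (x ∷ xs)))

D : List ℕ → ℕ
D l = passesFuel (length l) l

permList : {n : ℕ} → (Fin n → Fin n) → List ℕ
permList p = tabulate (toℕ ∘ p)

_≺[_]_ : {n : ℕ} → Fin n → (Fin n → Fin n) → Fin n → Set
i ≺[ p ] j = (toℕ i < toℕ j) × (toℕ (p j) < toℕ (p i))

{-# OPTIONS --safe #-}
module Submission where

-- An entry discarded by a pass is at most the running maximum at its position, which is an
-- earlier entry of the list. So a weakly decreasing subsequence of the discarded entries, of
-- length D - 1 by induction, extends at the front by one earlier entry: every list has a weakly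
-- decreasing subsequence of length D. For a permutation such a subsequence is strictly
-- decreasing, and its positions form a ≺-chain.

open import Defs
open import Data.Nat using (ℕ; zero; suc; _≤_; _≥_; _<ᵇ_; z≤n; s≤s)
open import Data.Nat.Properties using (≤∧≢⇒<; ≮⇒≥; <⇒<ᵇ; suc-injective)
open import Data.Bool using (true; false; T)
open import Data.Fin using (Fin; toℕ; zero; suc; _<_)
open import Data.Fin.Properties using (toℕ-injective; <⇒≢)
open import Data.List using (List; []; _∷_; length; tabulate; lookup; map; head)
open import Data.List.Properties using (length-map; map-∘)
open import Data.List.Relation.Binary.Sublist.Propositional using (_⊆_; []; _∷_; _∷ʳ_; ⊆-trans; minimum)
open import Data.List.Relation.Unary.Linked as Linked using (Linked; []; [-]; _∷_; _∷′_)
open import Data.List.Relation.Unary.Linked.Properties using (map⁺; map⁻)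
open import Data.Maybe using (just)
open import Data.Maybe.Relation.Binary.Connected using (Connected; just; just-nothing)
open import Data.Product using (Σ; ∃; _×_; _,_; proj₂; uncurry)
open import Data.Sum using (_⊎_; inj₁; inj₂)
open import Function using (_∘_)
open import Function.Definitions using (Injective)
open import Level using (Level)
open import Relation.Binary.Core using (Rel)
open import Relation.Binary.PropositionalEquality using (_≡_; refl; sym; trans; cong; subst)

private
  variable
    a ℓ : Level
    A : Set a

discardedFrom : ℕ → List ℕ → List ℕ
discardedFrom m xs = proj₂ (passFrom m xs)

discardedFrom-⊆ : ∀ m xs → discardedFrom m xs ⊆ xs
discardedFrom-⊆ m [] = []
discardedFrom-⊆ m (x ∷ xs) with m <ᵇ x
... | true  = x ∷ʳ discardedFrom-⊆ x xs
... | false = refl ∷ discardedFrom-⊆ m xs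

discardedFrom-dominated : ∀ m xs {w ws} → (w ∷ ws) ⊆ discardedFrom m xs →
  (w ≤ m × (w ∷ ws) ⊆ xs) ⊎ ∃ λ z → w ≤ z × (z ∷ w ∷ ws) ⊆ xs
discardedFrom-dominated m (x ∷ xs) w∷ws⊆ with m <ᵇ x in m<ᵇx
... | true with discardedFrom-dominated x xs w∷ws⊆
...   | inj₁ (w≤x , w∷ws⊆xs)      = inj₂ (x , w≤x , refl ∷ w∷ws⊆xs)
...   | inj₂ (z , w≤z , z∷w∷ws⊆xs) = inj₂ (z , w≤z , x ∷ʳ z∷w∷ws⊆xs)
discardedFrom-dominated m (x ∷ xs) (refl ∷ ws⊆) | false =
  inj₁ (≮⇒≥ (λ m<x → subst T m<ᵇx (<⇒<ᵇ m<x)) , refl ∷ ⊆-trans ws⊆ (discardedFrom-⊆ m xs))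
discardedFrom-dominated m (x ∷ xs) (_ ∷ʳ w∷ws⊆) | false with discardedFrom-dominated m xs w∷ws⊆
...   | inj₁ (w≤m , w∷ws⊆xs)      = inj₁ (w≤m , x ∷ʳ w∷ws⊆xs)
...   | inj₂ (z , w≤z , z∷w∷ws⊆xs) = inj₂ (z , w≤z , x ∷ʳ z∷w∷ws⊆xs)

discarded-dominated : ∀ xs {w ws} → (w ∷ ws) ⊆ discarded xs →
  ∃ λ z → w ≤ z × (z ∷ w ∷ ws) ⊆ xs
discarded-dominated (x ∷ xs) w∷ws⊆ with discardedFrom-dominated x xs w∷ws⊆
... | inj₁ (w≤x , w∷ws⊆xs)      = x , w≤x , refl ∷ w∷ws⊆xs
... | inj₂ (z , w≤z , z∷w∷ws⊆xs) = z , w≤z , x ∷ʳ z∷w∷ws⊆xs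

descendingSublist-passesFuel : ∀ fuel xs →
  ∃ λ cs → length cs ≡ passesFuel fuel xs × cs ⊆ xs × Linked _≥_ cs
descendingSublist-passesFuel fuel       []       = [] , refl , [] , []
descendingSublist-passesFuel zero       (x ∷ xs) = [] , refl , minimum _ , []
descendingSublist-passesFuel (suc fuel) (x ∷ xs)
  with descendingSublist-passesFuel fuel (discarded (x ∷ xs))
... | [] , |cs| , _ , _ = x ∷ [] , cong suc |cs| , refl ∷ minimum xs , [-]
... | w ∷ ws , |cs| , cs⊆ , cs↘ with discarded-dominated (x ∷ xs) cs⊆
...   | z , w≤z , z∷cs⊆ = z ∷ w ∷ ws , cong suc |cs| , z∷cs⊆ , w≤z ∷ cs↘

⊆-tabulate⁻ : ∀ {n} (f : Fin n → A) {xs} → xs ⊆ tabulate f →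
  ∃ λ is → map f is ≡ xs × Linked _<_ is
⊆-tabulate⁻ {n = zero}  f []           = [] , refl , []
⊆-tabulate⁻ {n = suc n} f (_ ∷ʳ xs⊆) with ⊆-tabulate⁻ (f ∘ suc) xs⊆
... | is , refl , is↗ = map suc is , sym (map-∘ is) , map⁺ (Linked.map s≤s is↗)
⊆-tabulate⁻ {n = suc n} f (refl ∷ xs⊆) with ⊆-tabulate⁻ (f ∘ suc) xs⊆
... | is , refl , is↗ =
  zero ∷ map suc is , cong (f zero ∷_) (sym (map-∘ is)) ,
  zero<head is ∷′ map⁺ (Linked.map s≤s is↗)
  where
    zero<head : (is : List (Fin n)) → Connected _<_ (just zero) (head (map suc is))
    zero<head []      = just-nothing
    zero<head (_ ∷ _) = just (s≤s z≤n)

Linked-lookup : ∀ {R : Rel A ℓ} {xs} → Linked R xs →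
  (k k′ : Fin (length xs)) → suc (toℕ k) ≡ toℕ k′ → R (lookup xs k) (lookup xs k′)
Linked-lookup (Rxy ∷ _)   zero    (suc zero) refl = Rxy
Linked-lookup (_ ∷ Rys)   (suc k) (suc k′)   eq   = Linked-lookup Rys k k′ (suc-injective eq)

module _ {n : ℕ} (p : Fin n → Fin n) where

  Chain : ℕ → Set
  Chain m = Σ (Fin m → Fin n) λ c → (k k′ : Fin m) → suc (toℕ k) ≡ toℕ k′ → c k ≺[ p ] c k′

  Linked⇒Chain : ∀ {is} → Linked _≺[ p ]_ is → Chain (length is)
  Linked⇒Chain {is} is≺ = lookup is , Linked-lookup is≺

  <∧≥⇒≺ : Injective _≡_ _≡_ p → ∀ {i j} → i < j → toℕ (p i) ≥ toℕ (p j) → i ≺[ p ] j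
  <∧≥⇒≺ p-inj i<j pi≥pj =
    i<j , ≤∧≢⇒< pi≥pj (λ pj≡pi → <⇒≢ i<j (sym (p-inj (toℕ-injective pj≡pi))))

mainTheorem4 : (n : ℕ) (p : Fin n → Fin n) → Injective _≡_ _≡_ p →
    Σ (Fin (D (permList p)) → Fin n) λ c →
      (k k′ : Fin (D (permList p))) → suc (toℕ k) ≡ toℕ k′ → c k ≺[ p ] c k′
mainTheorem4 n p p-inj with descendingSublist-passesFuel (length (permList p)) (permList p)
... | cs , |cs|≡D , cs⊆ , cs↘ with ⊆-tabulate⁻ (toℕ ∘ p) cs⊆
...   | is , refl , is↗ =
  subst (Chain p) (trans (sym (length-map (toℕ ∘ p) is)) |cs|≡D)
    (Linked⇒Chain p (Linked.zipWith (uncurry (<∧≥⇒≺ p p-inj)) (is↗ , map⁻ cs↘)))
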